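{- Let $G$ be a cubic quadrangulation, and let $A \cup B$ be a bipartition of $G$. For $X \in \{A,B\}$ and $i\in\{3,4\}$ let $\nu_{X,i}$ be the number of vertices in $X$ of degree $i$. Then \[ 3\nu_{A,3} + 2\left(\nu_{A,4}-\nu_{B,4}\right) = 12, \] and in particular $\nu_{A,3} \equiv 0 \pmod 2$ and $\nu_{A,4} \equiv \nu_{B,4} \pmod 3$.
   Context: A cubic quadrangulation is a cellular embedding of a (multi)graph $G$ in the sphere $S^2$ such that every vertex of $G$ has degree 3 or 4 and every face of the embedding is a quadrangle (boundary walk of length 4). Such a graph is always bipartite; $A\cup B$ denotes a partition of its vertex set into two classes with every edge joining $A$ to $B$. -}

module Defs where

import Agda.Primitive
open import Data.Nat using (ℕ; zero; suc; _+_; _*_; _≤_; _≤?_)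
open import Data.Nat.Properties using (_≟_)
open import Data.Fin using (Fin; toℕ)
open import Data.Fin.Properties using (all?; any?) renaming (_≟_ to _≟ᶠ_)
open import Data.Bool using (Bool; true; false)
open import Data.Bool.Properties using () renaming (_≟_ to _≟ᵇ_)
open import Data.List using (List; length; filter)
open import Data.Product using (Σ; ∃; _×_; _,_)
open import Data.Sum using (_⊎_)
open import Function using (_∘_)
open import Relation.Binary.PropositionalEquality using (_≡_; _≢_)
open import Relation.Nullary using (Dec; yes; no)
open import Relation.Nullary.Decidable using (_×-dec_)
open import Relation.Unary using (Pred; Decidable)
import Data.List as L

iter : ∀ {A : Set} → (A → A) → ℕ → A → A
iter f zero    x = x
iter f (suc k) x = f (iter f k x)

count : ∀ {n} {P : Pred (Fin n) Agda.Primitive.lzero} → Decidable P → ℕ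
count {n} P? = length (filter P? (L.allFin n))

-- Combinatorial map (rotation system) on the dart set Fin n:
--   σ : rotation around vertices (a permutation),
--   α : fixed-point-free involution pairing the two darts of each edge.
-- Vertices = σ-orbits, edges = α-orbits, faces = (σ ∘ α)-orbits.
record Map : Set where
  field
    n     : ℕ
    σ     : Fin n → Fin n
    σ⁻¹   : Fin n → Fin n
    σσ⁻¹  : ∀ d → σ (σ⁻¹ d) ≡ d
    σ⁻¹σ  : ∀ d → σ⁻¹ (σ d) ≡ d
    α     : Fin n → Fin n
    αα    : ∀ d → α (α d) ≡ d
    α-fpf : ∀ d → α d ≢ d

  φ : Fin n → Fin n
  φ = σ ∘ α

  IsRep : (Fin n → Fin n) → Fin n → Set
  IsRep p d = ∀ (k : Fin n) → toℕ d ≤ toℕ (iter p (toℕ k) d)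

  isRep? : (p : Fin n → Fin n) → Decidable (IsRep p)
  isRep? p d = all? (λ k → toℕ d ≤? toℕ (iter p (toℕ k) d))

  #orbits : (Fin n → Fin n) → ℕ
  #orbits p = count (isRep? p)

  InOrbit : (Fin n → Fin n) → Fin n → Fin n → Set
  InOrbit p d e = ∃ λ (k : Fin n) → iter p (toℕ k) d ≡ e

  orbitSize : (Fin n → Fin n) → Fin n → ℕ
  orbitSize p d = count {P = InOrbit p d} (λ e → any? (λ k → iter p (toℕ k) d ≟ᶠ e))

  V : ℕ
  V = #orbits σ

  F : ℕ
  F = #orbits φ

  -- number of edges is n / 2; Euler formula V - E + F = 2 multiplied by 2
  -- (ℕ-subtraction free): 2V + 2F = 4 + 2E = 4 + n
  EulerSphere : Set
  EulerSphere = 2 * V + 2 * F ≡ 4 + n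

  -- connectivity: the group generated by σ, α acts transitively on darts
  data Reach : Fin n → Fin n → Set where
    here  : ∀ {d} → Reach d d
    stepσ : ∀ {d e} → Reach d e → Reach d (σ e)
    stepα : ∀ {d e} → Reach d e → Reach d (α e)

  Connected : Set
  Connected = ∀ d e → Reach d e

  deg : Fin n → ℕ
  deg d = orbitSize σ d

  faceLen : Fin n → ℕ
  faceLen d = orbitSize φ d

  -- cellular embedding in the sphere = connected map of genus 0
  IsSphereMap : Set
  IsSphereMap = Connected × EulerSphere

  IsCubicQuadrangulation : Set
  IsCubicQuadrangulation =
    IsSphereMap × (∀ d → deg d ≡ 3 ⊎ deg d ≡ 4) × (∀ d → faceLen d ≡ 4)

  -- bipartition A ∪ B given by a colouring of darts constant on vertices
  -- (true = A, false = B), with each edge joining the two classes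
  IsBipartition : (Fin n → Bool) → Set
  IsBipartition c = (∀ d → c (σ d) ≡ c d) × (∀ d → c (α d) ≢ c d)

  ν : (Fin n → Bool) → Bool → ℕ → ℕ
  ν c X i = count (λ d → isRep? σ d ×-dec ((c d ≟ᵇ X) ×-dec (deg d ≟ i)))

module Submission where

-- Proposition 3.2 is a double count of darts (half-edges).  With n darts,
-- V vertices (σ-orbits) and F faces (φ-orbits):
--   * every face has 4 darts, so n = 4F;
--   * a vertex of degree i carries i darts, so the vertices of colour X carry
--     3ν_{X,3} + 4ν_{X,4} darts, and n is the sum over both colours;
--   * the edge involution α swaps colours, so both colours carry equally many;
--   * V = ν_{A,3} + ν_{A,4} + ν_{B,3} + ν_{B,4}, and Euler gives 2V + 2F = 4 + n.
-- A linear combination of these is 3ν_{A,3} + 2(ν_{A,4} - ν_{B,4}) = 12, which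
-- yields the two congruences.

open import Defs
open import Data.Nat using (ℕ; zero; suc; _+_; _*_; _≤_; _<_; _≤?_; s≤s; _%_; _/_)
open import Data.Nat.Properties
open import Data.Nat.DivMod using (m≡m%n+[m/n]*n; m%n<n; [m+kn]%n≡m%n)
open import Data.Nat.Tactic.RingSolver using (solve-∀)
open import Data.Bool using (Bool; true; false; if_then_else_)
open import Data.Bool.Properties using () renaming (_≟_ to _≟ᵇ_)
open import Data.Fin using (Fin; zero; suc; toℕ; fromℕ<)
open import Data.Fin.Properties
  using (all?; any?; toℕ-injective; toℕ<n; toℕ-fromℕ<; pigeonhole; ¬∀⟶∃¬)
  renaming (_≟_ to _≟ᶠ_; suc-injective to Fin-suc-injective)
import Data.Fin.Permutation as Permutation
open import Data.List using (filter; tabulate; length)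
open import Data.Product using (_×_; _,_; ∃; ∃-syntax)
open import Data.Sum using (_⊎_; inj₁; inj₂)
open import Data.Empty using (⊥-elim)
open import Function using (_∘_; id)
open import Relation.Binary.PropositionalEquality
open import Relation.Nullary using (Dec; yes; no; does; ¬_)
open import Relation.Nullary.Decidable using (_×-dec_)
open import Relation.Unary using (Pred; Decidable)
open import Level using (0ℓ)
open import Algebra.Properties.Semiring.Sum +-*-semiring
  using (sum; sum-cong-≗; ∑-comm; ∑-distrib-+; ∑-permute; *-distribˡ-sum; *-distribʳ-sum;
         sum-replicate-zero)

open ≡-Reasoning

ind : ∀ {P : Set} → Dec P → ℕ
ind d = if does d then 1 else 0

ind-yes : ∀ {P : Set} (d : Dec P) → P → ind d ≡ 1
ind-yes (yes _) _ = refl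
ind-yes (no ¬p) p = ⊥-elim (¬p p)

ind-no : ∀ {P : Set} (d : Dec P) → ¬ P → ind d ≡ 0
ind-no (yes p) ¬p = ⊥-elim (¬p p)
ind-no (no _)  _  = refl

ind-⇔ : ∀ {P Q : Set} (d : Dec P) (e : Dec Q) → (P → Q) → (Q → P) → ind d ≡ ind e
ind-⇔ (yes p) e to _    = sym (ind-yes e (to p))
ind-⇔ (no ¬p) e _  from = sym (ind-no e (¬p ∘ from))

ind-× : ∀ {P Q : Set} (d : Dec P) (e : Dec Q) → ind (d ×-dec e) ≡ ind d * ind e
ind-× (yes _) (yes _) = refl
ind-× (yes _) (no _)  = refl
ind-× (no _)  _       = refl

ind-*-ind-zero : ∀ {P Q : Set} (d : Dec P) (e : Dec Q) → ¬ (P × Q) →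
  ∀ x → ind d * x * ind e ≡ 0
ind-*-ind-zero (yes p) (yes q) ¬pq x = ⊥-elim (¬pq (p , q))
ind-*-ind-zero (yes _) (no _)  ¬pq x = *-zeroʳ (x + 0)
ind-*-ind-zero (no _)  _       ¬pq x = refl

count-sum : ∀ {n} {P : Pred (Fin n) 0ℓ} (P? : Decidable P) →
  count P? ≡ sum (λ i → ind (P? i))
count-sum {n} P? = filter-tabulate id
  where
  filter-tabulate : ∀ {m} (f : Fin m → Fin n) →
    length (filter P? (tabulate f)) ≡ sum (λ i → ind (P? (f i)))
  filter-tabulate {zero}  f = refl
  filter-tabulate {suc m} f with does (P? (f zero))
  ... | true  = cong suc (filter-tabulate (f ∘ suc))
  ... | false = filter-tabulate (f ∘ suc)

∑-one : ∀ n → sum {n} (λ _ → 1) ≡ n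
∑-one zero    = refl
∑-one (suc n) = cong suc (∑-one n)

∑-single : ∀ {n} (f : Fin n → ℕ) (i₀ : Fin n) → (∀ i → i ≢ i₀ → f i ≡ 0) → sum f ≡ f i₀
∑-single {suc n} f zero h =
  trans (cong (f zero +_) (trans (sum-cong-≗ (λ i → h (suc i) λ ())) (sum-replicate-zero n)))
        (+-identityʳ _)
∑-single f (suc i₀) h =
  trans (cong (_+ sum (f ∘ suc)) (h zero λ ()))
        (∑-single (f ∘ suc) i₀ (λ i i≢i₀ → h (suc i) (i≢i₀ ∘ Fin-suc-injective)))

∑-involution : ∀ {n} (ι : Fin n → Fin n) → (∀ d → ι (ι d) ≡ d) →
  (f : Fin n → ℕ) → sum (f ∘ ι) ≡ sum f
∑-involution ι ιι f = sym (∑-permute f (Permutation.permutation ι ι ιι ιι))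

-- A
-- representative of an orbit is its least element; the notions below are
-- exactly those used by 'Map' for vertices and faces.
module Orbits {n : ℕ} (p q : Fin n → Fin n) (q∘p : ∀ d → q (p d) ≡ d) where

  iter-+ : ∀ a b d → iter p (a + b) d ≡ iter p a (iter p b d)
  iter-+ zero    b d = refl
  iter-+ (suc a) b d = cong p (iter-+ a b d)

  iter-injective : ∀ k {x y} → iter p k x ≡ iter p k y → x ≡ y
  iter-injective zero    eq = eq
  iter-injective (suc k) eq =
    iter-injective k (trans (sym (q∘p _)) (trans (cong q eq) (q∘p _)))

  -- By pigeonhole, every dart comes back to itself within n steps.
  period : ∀ d → ∃[ m ] suc m ≤ n × iter p (suc m) d ≡ d
  period d with pigeonhole (n<1+n n) (λ (i : Fin (suc n)) → iter p (toℕ i) d)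
  ... | i , j , i<j , same with m≤n⇒∃[o]m+o≡n i<j
  ... | m , i+1+m≡j = m , bound , iter-injective (toℕ i) returns
    where
    i+1+m≡j′ : toℕ i + suc m ≡ toℕ j
    i+1+m≡j′ = trans (+-suc (toℕ i) m) i+1+m≡j

    bound : suc m ≤ n
    bound = ≤-trans (m≤n+m (suc m) (toℕ i))
              (≤-trans (≤-reflexive i+1+m≡j′) (≤-pred (toℕ<n j)))

    returns : iter p (toℕ i) (iter p (suc m) d) ≡ iter p (toℕ i) d
    returns = begin
      iter p (toℕ i) (iter p (suc m) d)  ≡⟨ iter-+ (toℕ i) (suc m) d ⟨
      iter p (toℕ i + suc m) d           ≡⟨ cong (λ k → iter p k d) i+1+m≡j′ ⟩
      iter p (toℕ j) d                   ≡⟨ same ⟨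
      iter p (toℕ i) d                   ∎

  iter-period : ∀ {d} m → iter p (suc m) d ≡ d → ∀ t → iter p (t * suc m) d ≡ d
  iter-period m back zero    = refl
  iter-period {d} m back (suc t) =
    trans (iter-+ (suc m) (t * suc m) d)
          (trans (cong (iter p (suc m)) (iter-period m back t)) back)

  _↝_ : Fin n → Fin n → Set
  d ↝ e = ∃[ k ] iter p k d ≡ e

  ↝-trans : ∀ {d e f} → d ↝ e → e ↝ f → d ↝ f
  ↝-trans {d} (a , refl) (b , refl) = b + a , iter-+ b a d

  ↝-sym : ∀ {d e} → d ↝ e → e ↝ d
  ↝-sym {d} (k , refl) with period d
  ... | m , _ , back = m * k , (begin
    iter p (m * k) (iter p k d)  ≡⟨ iter-+ (m * k) k d ⟨
    iter p (m * k + k) d         ≡⟨ cong (λ s → iter p s d) (trans (+-comm (m * k) k) (*-comm (suc m) k)) ⟩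
    iter p (k * suc m) d         ≡⟨ iter-period m back k ⟩
    d                            ∎)

  IsRep : Fin n → Set
  IsRep d = ∀ (k : Fin n) → toℕ d ≤ toℕ (iter p (toℕ k) d)

  isRep? : Decidable IsRep
  isRep? d = all? (λ k → toℕ d ≤? toℕ (iter p (toℕ k) d))

  InOrbit : Fin n → Fin n → Set
  InOrbit d e = ∃ λ (k : Fin n) → iter p (toℕ k) d ≡ e

  inOrbit? : ∀ d → Decidable (InOrbit d)
  inOrbit? d e = any? (λ k → iter p (toℕ k) d ≟ᶠ e)

  orbitSize : Fin n → ℕ
  orbitSize d = count (inOrbit? d)

  -- Reachability needs fewer than n steps (reduce the step count modulo a period).
  ↝⇒InOrbit : ∀ {d e} → d ↝ e → InOrbit d e
  ↝⇒InOrbit {d} (k , refl) with period d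
  ... | m , m<n , back = fromℕ< k%<n , (begin
    iter p (toℕ (fromℕ< k%<n)) d               ≡⟨ cong (λ s → iter p s d) (toℕ-fromℕ< k%<n) ⟩
    iter p (k % suc m) d                        ≡⟨ cong (iter p (k % suc m)) (iter-period m back (k / suc m)) ⟨
    iter p (k % suc m) (iter p (k / suc m * suc m) d)  ≡⟨ iter-+ (k % suc m) _ d ⟨
    iter p (k % suc m + k / suc m * suc m) d    ≡⟨ cong (λ s → iter p s d) (m≡m%n+[m/n]*n k (suc m)) ⟨
    iter p k d                                  ∎)
    where k%<n = ≤-trans (m%n<n k (suc m)) m<n

  InOrbit⇒↝ : ∀ {d e} → InOrbit d e → d ↝ e
  InOrbit⇒↝ (k , eq) = toℕ k , eq

  rep-least : ∀ {r e} → IsRep r → r ↝ e → toℕ r ≤ toℕ e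
  rep-least R r↝e with ↝⇒InOrbit r↝e
  ... | k , refl = R k

  rep-unique : ∀ {r r′ e} → IsRep r → IsRep r′ → r ↝ e → r′ ↝ e → r ≡ r′
  rep-unique R R′ r↝e r′↝e = toℕ-injective (≤-antisym
    (rep-least R  (↝-trans r↝e  (↝-sym r′↝e)))
    (rep-least R′ (↝-trans r′↝e (↝-sym r↝e))))

  -- Every orbit has a representative: descend along smaller orbit elements.
  representative : ∀ e → ∃[ r ] IsRep r × r ↝ e
  representative e = descend (suc (toℕ e)) e ≤-refl
    where
    descend : ∀ fuel e → toℕ e < fuel → ∃[ r ] IsRep r × r ↝ e
    descend (suc fuel) e (s≤s e≤fuel) with isRep? e
    ... | yes R = e , R , (0 , refl)
    ... | no ¬R with ¬∀⟶∃¬ n _ (λ k → toℕ e ≤? toℕ (iter p (toℕ k) e)) ¬R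
    ... | k , smaller with descend fuel (iter p (toℕ k) e) (≤-trans (≰⇒> smaller) e≤fuel)
    ... | r , R , r↝e′ = r , R , ↝-trans r↝e′ (↝-sym (toℕ k , refl))

  constant-on-orbit : (f : Fin n → ℕ) → (∀ d → f (p d) ≡ f d) → ∀ {d e} → d ↝ e → f e ≡ f d
  constant-on-orbit f inv (zero  , refl) = refl
  constant-on-orbit f inv (suc k , refl) = trans (inv _) (constant-on-orbit f inv (k , refl))

  orbitSize-invariant : ∀ d → orbitSize (p d) ≡ orbitSize d
  orbitSize-invariant d = begin
    count (inOrbit? (p d))               ≡⟨ count-sum (inOrbit? (p d)) ⟩
    sum (λ e → ind (inOrbit? (p d) e))   ≡⟨ sum-cong-≗ same-orbit ⟩
    sum (λ e → ind (inOrbit? d e))       ≡⟨ count-sum (inOrbit? d) ⟨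
    count (inOrbit? d)                   ∎
    where
    step : d ↝ p d
    step = 1 , refl
    same-orbit : ∀ e → ind (inOrbit? (p d) e) ≡ ind (inOrbit? d e)
    same-orbit e = ind-⇔ (inOrbit? (p d) e) (inOrbit? d e)
      (λ o → ↝⇒InOrbit (↝-trans step (InOrbit⇒↝ o)))
      (λ o → ↝⇒InOrbit (↝-trans (↝-sym step) (InOrbit⇒↝ o)))

  orbit-sum : (f : Fin n → ℕ) → (∀ d → f (p d) ≡ f d) →
    sum f ≡ sum (λ r → ind (isRep? r) * (f r * orbitSize r))
  orbit-sum f inv = sym (begin
    sum (λ r → ind (isRep? r) * (f r * orbitSize r))
      ≡⟨ sum-cong-≗ expand ⟩
    sum (λ r → sum (λ e → share r e))
      ≡⟨ ∑-comm share ⟩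
    sum (λ e → sum (λ r → share r e))
      ≡⟨ sum-cong-≗ collect ⟩
    sum f ∎)
    where
    share : Fin n → Fin n → ℕ
    share r e = ind (isRep? r) * f r * ind (inOrbit? r e)

    expand : ∀ r → ind (isRep? r) * (f r * orbitSize r) ≡ sum (share r)
    expand r = begin
      ind (isRep? r) * (f r * orbitSize r)
        ≡⟨ *-assoc (ind (isRep? r)) (f r) _ ⟨
      ind (isRep? r) * f r * orbitSize r
        ≡⟨ cong (ind (isRep? r) * f r *_) (count-sum (inOrbit? r)) ⟩
      ind (isRep? r) * f r * sum (λ e → ind (inOrbit? r e))
        ≡⟨ *-distribˡ-sum (ind (isRep? r) * f r) (λ e → ind (inOrbit? r e)) ⟩
      sum (share r) ∎

    -- only the representative of e's orbit contributes to e, and it gives f e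
    collect : ∀ e → sum (λ r → share r e) ≡ f e
    collect e with representative e
    ... | r₀ , R₀ , r₀↝e = begin
      sum (λ r → share r e)  ≡⟨ ∑-single (λ r → share r e) r₀ elsewhere ⟩
      share r₀ e             ≡⟨ cong₂ (λ a b → a * f r₀ * b) (ind-yes (isRep? r₀) R₀)
                                       (ind-yes (inOrbit? r₀ e) (↝⇒InOrbit r₀↝e)) ⟩
      1 * f r₀ * 1           ≡⟨ trans (*-identityʳ (1 * f r₀)) (*-identityˡ (f r₀)) ⟩
      f r₀                   ≡⟨ constant-on-orbit f inv r₀↝e ⟨
      f e                    ∎
      where
      elsewhere : ∀ r → r ≢ r₀ → share r e ≡ 0
      elsewhere r r≢r₀ = ind-*-ind-zero (isRep? r) (inOrbit? r e)
        (λ (R , o) → r≢r₀ (rep-unique R R₀ (InOrbit⇒↝ o) r₀↝e)) (f r)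

colour-split : ∀ b → 1 ≡ ind (b ≟ᵇ true) + ind (b ≟ᵇ false)
colour-split true  = refl
colour-split false = refl

degree-split : ∀ x → x ≡ 3 ⊎ x ≡ 4 → 1 ≡ ind (x ≟ 3) + ind (x ≟ 4)
degree-split .3 (inj₁ refl) = refl
degree-split .4 (inj₂ refl) = refl

opposite-colours : ∀ b b′ → b′ ≢ b → ind (b′ ≟ᵇ true) ≡ ind (b ≟ᵇ false)
opposite-colours true  true  b′≢b = ⊥-elim (b′≢b refl)
opposite-colours true  false _    = refl
opposite-colours false true  _    = refl
opposite-colours false false b′≢b = ⊥-elim (b′≢b refl)

ind-≟-scale : ∀ x i → ind (x ≟ i) * x ≡ ind (x ≟ i) * i
ind-≟-scale x i = scale (x ≟ i)
  where
  scale : (d : Dec (x ≡ i)) → ind d * x ≡ ind d * i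
  scale (yes refl) = refl
  scale (no _)     = refl

module DartCounts (M : Map) where
  open Map M

  module Vertices = Orbits σ σ⁻¹ σ⁻¹σ
  module Faces    = Orbits φ (α ∘ σ⁻¹) (λ d → trans (cong α (σ⁻¹σ (α d))) (αα d))

  darts-of-faces : ∀ k → (∀ d → faceLen d ≡ k) → n ≡ F * k
  darts-of-faces k faces-k = begin
    n                                                  ≡⟨ ∑-one n ⟨
    sum {n} (λ _ → 1)                                  ≡⟨ Faces.orbit-sum (λ _ → 1) (λ _ → refl) ⟩
    sum (λ r → ind (isRep? φ r) * (1 * faceLen r))     ≡⟨ sum-cong-≗ (λ r → cong (λ s → ind (isRep? φ r) * s)
                                                            (trans (*-identityˡ _) (faces-k r))) ⟩
    sum (λ r → ind (isRep? φ r) * k)                   ≡⟨ *-distribʳ-sum k (λ r → ind (isRep? φ r)) ⟨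
    sum (λ r → ind (isRep? φ r)) * k                   ≡⟨ cong (_* k) (count-sum (isRep? φ)) ⟨
    F * k                                              ∎

  module Coloured (c : Fin n → Bool) where

    inClass : Bool → ℕ → Fin n → ℕ
    inClass X i d = ind (c d ≟ᵇ X) * ind (deg d ≟ i)

    colourDarts : Bool → ℕ
    colourDarts X = sum (λ d → ind (c d ≟ᵇ X))

    ν-sum : ∀ X i → ν c X i ≡ sum (λ r → ind (isRep? σ r) * inClass X i r)
    ν-sum X i = trans (count-sum (λ d → isRep? σ d ×-dec ((c d ≟ᵇ X) ×-dec (deg d ≟ i))))
      (sum-cong-≗ λ r → trans (ind-× (isRep? σ r) ((c r ≟ᵇ X) ×-dec (deg r ≟ i)))
                              (cong (ind (isRep? σ r) *_) (ind-× (c r ≟ᵇ X) (deg r ≟ i))))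

    darts-of-class : (∀ d → c (σ d) ≡ c d) → ∀ X i → sum (inClass X i) ≡ i * ν c X i
    darts-of-class c-σ X i = begin
      sum (inClass X i)
        ≡⟨ Vertices.orbit-sum (inClass X i) invariant ⟩
      sum (λ r → ind (isRep? σ r) * (inClass X i r * deg r))
        ≡⟨ sum-cong-≗ (λ r → trans (cong (ind (isRep? σ r) *_) (degree-is-i r))
                                   (sym (*-assoc (ind (isRep? σ r)) _ i))) ⟩
      sum (λ r → ind (isRep? σ r) * inClass X i r * i)
        ≡⟨ *-distribʳ-sum i (λ r → ind (isRep? σ r) * inClass X i r) ⟨
      sum (λ r → ind (isRep? σ r) * inClass X i r) * i
        ≡⟨ cong (_* i) (ν-sum X i) ⟨
      ν c X i * i
        ≡⟨ *-comm (ν c X i) i ⟩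
      i * ν c X i ∎
      where
      invariant : ∀ d → inClass X i (σ d) ≡ inClass X i d
      invariant d = cong₂ (λ b x → ind (b ≟ᵇ X) * ind (x ≟ i)) (c-σ d) (Vertices.orbitSize-invariant d)

      degree-is-i : ∀ r → inClass X i r * deg r ≡ inClass X i r * i
      degree-is-i r = begin
        ind (c r ≟ᵇ X) * ind (deg r ≟ i) * deg r    ≡⟨ *-assoc (ind (c r ≟ᵇ X)) _ _ ⟩
        ind (c r ≟ᵇ X) * (ind (deg r ≟ i) * deg r)  ≡⟨ cong (ind (c r ≟ᵇ X) *_) (ind-≟-scale (deg r) i) ⟩
        ind (c r ≟ᵇ X) * (ind (deg r ≟ i) * i)      ≡⟨ *-assoc (ind (c r ≟ᵇ X)) _ _ ⟨
        inClass X i r * i                           ∎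

    colour-by-degree : (∀ d → deg d ≡ 3 ⊎ deg d ≡ 4) →
      ∀ X → colourDarts X ≡ sum (inClass X 3) + sum (inClass X 4)
    colour-by-degree deg34 X = trans (sum-cong-≗ split) (∑-distrib-+ (inClass X 3) (inClass X 4))
      where
      split : ∀ d → ind (c d ≟ᵇ X) ≡ inClass X 3 d + inClass X 4 d
      split d = begin
        ind (c d ≟ᵇ X)                                ≡⟨ *-identityʳ _ ⟨
        ind (c d ≟ᵇ X) * 1                            ≡⟨ cong (ind (c d ≟ᵇ X) *_) (degree-split (deg d) (deg34 d)) ⟩
        ind (c d ≟ᵇ X) * (ind (deg d ≟ 3) + ind (deg d ≟ 4))  ≡⟨ *-distribˡ-+ (ind (c d ≟ᵇ X)) _ _ ⟩
        inClass X 3 d + inClass X 4 d                 ∎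

    darts-of-colour : (∀ d → c (σ d) ≡ c d) → (∀ d → deg d ≡ 3 ⊎ deg d ≡ 4) →
      ∀ X → colourDarts X ≡ 3 * ν c X 3 + 4 * ν c X 4
    darts-of-colour c-σ deg34 X = trans (colour-by-degree deg34 X)
      (cong₂ _+_ (darts-of-class c-σ X 3) (darts-of-class c-σ X 4))

    darts-by-colour : n ≡ colourDarts true + colourDarts false
    darts-by-colour = begin
      n                                                     ≡⟨ ∑-one n ⟨
      sum {n} (λ _ → 1)                                     ≡⟨ sum-cong-≗ (λ d → colour-split (c d)) ⟩
      sum (λ d → ind (c d ≟ᵇ true) + ind (c d ≟ᵇ false))    ≡⟨ ∑-distrib-+ (λ d → ind (c d ≟ᵇ true)) (λ d → ind (c d ≟ᵇ false)) ⟩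
      colourDarts true + colourDarts false                  ∎

    -- α pairs every dart with a dart of the other colour.
    colours-balanced : (∀ d → c (α d) ≢ c d) → colourDarts true ≡ colourDarts false
    colours-balanced c-α = begin
      colourDarts true                        ≡⟨ ∑-involution α αα _ ⟨
      sum (λ d → ind (c (α d) ≟ᵇ true))       ≡⟨ sum-cong-≗ (λ d → opposite-colours (c d) (c (α d)) (c-α d)) ⟩
      colourDarts false                       ∎

    vertices-by-class : (∀ d → deg d ≡ 3 ⊎ deg d ≡ 4) →
      V ≡ ν c true 3 + ν c true 4 + ν c false 3 + ν c false 4
    vertices-by-class deg34 = begin
      V                                      ≡⟨ count-sum (isRep? σ) ⟩
      sum (λ r → ind (isRep? σ r))           ≡⟨ sum-cong-≗ split ⟩
      sum (λ r → vertexIn true 3 r + vertexIn true 4 r + vertexIn false 3 r + vertexIn false 4 r)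
        ≡⟨ ∑-distrib-+₄ (vertexIn true 3) (vertexIn true 4) (vertexIn false 3) (vertexIn false 4) ⟩
      sum (vertexIn true 3) + sum (vertexIn true 4) + sum (vertexIn false 3) + sum (vertexIn false 4)
        ≡⟨ cong₂ _+_ (cong₂ _+_ (cong₂ _+_ (ν-sum true 3) (ν-sum true 4)) (ν-sum false 3)) (ν-sum false 4) ⟨
      ν c true 3 + ν c true 4 + ν c false 3 + ν c false 4 ∎
      where
      vertexIn : Bool → ℕ → Fin n → ℕ
      vertexIn X i r = ind (isRep? σ r) * inClass X i r

      ∑-distrib-+₄ : (f g h k : Fin n → ℕ) →
        sum (λ r → f r + g r + h r + k r) ≡ sum f + sum g + sum h + sum k
      ∑-distrib-+₄ f g h k =
        trans (∑-distrib-+ (λ r → f r + g r + h r) k) (cong (_+ sum k)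
        (trans (∑-distrib-+ (λ r → f r + g r) h) (cong (_+ sum h) (∑-distrib-+ f g))))

      distrib₄ : ∀ a w x y z → a * (w + x + y + z) ≡ a * w + a * x + a * y + a * z
      distrib₄ = solve-∀

      one-class : ∀ d → 1 ≡ inClass true 3 d + inClass true 4 d + inClass false 3 d + inClass false 4 d
      one-class d = begin
        1                                             ≡⟨ cong₂ _*_ (colour-split (c d)) (degree-split (deg d) (deg34 d)) ⟩
        (ind (c d ≟ᵇ true) + ind (c d ≟ᵇ false)) * (ind (deg d ≟ 3) + ind (deg d ≟ 4))
          ≡⟨ expand (ind (c d ≟ᵇ true)) (ind (c d ≟ᵇ false)) (ind (deg d ≟ 3)) (ind (deg d ≟ 4)) ⟩
        inClass true 3 d + inClass true 4 d + inClass false 3 d + inClass false 4 d ∎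
        where
        expand : ∀ a b x y → (a + b) * (x + y) ≡ a * x + a * y + b * x + b * y
        expand = solve-∀

      split : ∀ r → ind (isRep? σ r) ≡
        vertexIn true 3 r + vertexIn true 4 r + vertexIn false 3 r + vertexIn false 4 r
      split r = trans (sym (*-identityʳ _)) (trans (cong (ind (isRep? σ r) *_) (one-class r))
        (distrib₄ (ind (isRep? σ r)) (inClass true 3 r) (inClass true 4 r) (inClass false 3 r) (inClass false 4 r)))

-- Twice the goal is 6·Euler + 3·(faces) + (balance).
class-identity : ∀ a₃ a₄ b₃ b₄ F →
  2 * (a₃ + a₄ + b₃ + b₄) + 2 * F ≡ 4 + ((3 * a₃ + 4 * a₄) + (3 * b₃ + 4 * b₄)) →
  (3 * a₃ + 4 * a₄) + (3 * b₃ + 4 * b₄) ≡ F * 4 →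
  3 * a₃ + 4 * a₄ ≡ 3 * b₃ + 4 * b₄ →
  3 * a₃ + 2 * a₄ ≡ 12 + 2 * b₄
class-identity a₃ a₄ b₃ b₄ F euler faces balance =
  *-cancelˡ-≡ _ _ 2 (+-cancelʳ-≡ K _ _ (begin
    2 * (3 * a₃ + 2 * a₄) + K
      ≡⟨ cong (2 * (3 * a₃ + 2 * a₄) +_) (cong₂ _+_ (cong₂ _+_ (cong (6 *_) euler) (cong (3 *_) faces)) balance) ⟩
    2 * (3 * a₃ + 2 * a₄) + (6 * (4 + (SA + SB)) + 3 * (F * 4) + SB)
      ≡⟨ combination a₃ a₄ b₃ b₄ F ⟩
    2 * (12 + 2 * b₄) + K ∎))
  where
  SA SB K : ℕ
  SA = 3 * a₃ + 4 * a₄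
  SB = 3 * b₃ + 4 * b₄
  K = 6 * (2 * (a₃ + a₄ + b₃ + b₄) + 2 * F) + 3 * (SA + SB) + SA

  combination : ∀ a₃ a₄ b₃ b₄ F →
    2 * (3 * a₃ + 2 * a₄)
      + (6 * (4 + ((3 * a₃ + 4 * a₄) + (3 * b₃ + 4 * b₄))) + 3 * (F * 4) + (3 * b₃ + 4 * b₄))
    ≡ 2 * (12 + 2 * b₄)
      + (6 * (2 * (a₃ + a₄ + b₃ + b₄) + 2 * F) + 3 * ((3 * a₃ + 4 * a₄) + (3 * b₃ + 4 * b₄))
         + (3 * a₃ + 4 * a₄))
  combination = solve-∀

-- Reading the identity modulo 2: a₃ + 2(a₃ + a₄) = 2(6 + b₄).
class-identity-mod-2 : ∀ a₃ a₄ b₄ → 3 * a₃ + 2 * a₄ ≡ 12 + 2 * b₄ → a₃ % 2 ≡ 0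
class-identity-mod-2 a₃ a₄ b₄ identity = begin
  a₃ % 2                          ≡⟨ [m+kn]%n≡m%n a₃ (a₃ + a₄) 2 ⟨
  (a₃ + (a₃ + a₄) * 2) % 2        ≡⟨ cong (_% 2) (trans (regroup-left a₃ a₄) (trans identity (regroup-right b₄))) ⟩
  (0 + (6 + b₄) * 2) % 2          ≡⟨ [m+kn]%n≡m%n 0 (6 + b₄) 2 ⟩
  0                               ∎
  where
  regroup-left : ∀ a₃ a₄ → a₃ + (a₃ + a₄) * 2 ≡ 3 * a₃ + 2 * a₄
  regroup-left = solve-∀
  regroup-right : ∀ b₄ → 12 + 2 * b₄ ≡ 0 + (6 + b₄) * 2
  regroup-right = solve-∀

-- Reading twice the identity modulo 3: a₄ + 3(2a₃ + a₄) = b₄ + 3(8 + b₄).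
class-identity-mod-3 : ∀ a₃ a₄ b₄ → 3 * a₃ + 2 * a₄ ≡ 12 + 2 * b₄ → a₄ % 3 ≡ b₄ % 3
class-identity-mod-3 a₃ a₄ b₄ identity = begin
  a₄ % 3                          ≡⟨ [m+kn]%n≡m%n a₄ (2 * a₃ + a₄) 3 ⟨
  (a₄ + (2 * a₃ + a₄) * 3) % 3    ≡⟨ cong (_% 3) (trans (regroup-left a₃ a₄) (trans (cong (2 *_) identity) (regroup-right b₄))) ⟩
  (b₄ + (8 + b₄) * 3) % 3         ≡⟨ [m+kn]%n≡m%n b₄ (8 + b₄) 3 ⟩
  b₄ % 3                          ∎
  where
  regroup-left : ∀ a₃ a₄ → a₄ + (2 * a₃ + a₄) * 3 ≡ 2 * (3 * a₃ + 2 * a₄)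
  regroup-left = solve-∀
  regroup-right : ∀ b₄ → 2 * (12 + 2 * b₄) ≡ b₄ + (8 + b₄) * 3
  regroup-right = solve-∀

proposition3p2 : (M : Map) → Map.IsCubicQuadrangulation M →
    (c : Fin (Map.n M) → Bool) → Map.IsBipartition M c →
    (3 * Map.ν M c true 3 + 2 * Map.ν M c true 4 ≡ 12 + 2 * Map.ν M c false 4)
    × (Map.ν M c true 3 % 2 ≡ 0)
    × (Map.ν M c true 4 % 3 ≡ Map.ν M c false 4 % 3)
proposition3p2 M ((_ , euler) , deg34 , quadrangles) c (c-σ , c-α) =
  identity , class-identity-mod-2 a₃ a₄ b₄ identity , class-identity-mod-3 a₃ a₄ b₄ identity
  where
  open Map M
  open DartCounts M
  open Coloured c

  a₃ a₄ b₃ b₄ : ℕ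
  a₃ = ν c true 3 ; a₄ = ν c true 4 ; b₃ = ν c false 3 ; b₄ = ν c false 4

  colour-X-darts : ∀ X → colourDarts X ≡ 3 * ν c X 3 + 4 * ν c X 4
  colour-X-darts = darts-of-colour c-σ deg34

  darts : n ≡ (3 * a₃ + 4 * a₄) + (3 * b₃ + 4 * b₄)
  darts = trans darts-by-colour (cong₂ _+_ (colour-X-darts true) (colour-X-darts false))

  identity : 3 * a₃ + 2 * a₄ ≡ 12 + 2 * b₄
  identity = class-identity a₃ a₄ b₃ b₄ F
    (subst₂ (λ v m → 2 * v + 2 * F ≡ 4 + m) (vertices-by-class deg34) darts euler)
    (trans (sym darts) (darts-of-faces 4 quadrangles))
    (trans (sym (colour-X-darts true)) (trans (colours-balanced c-α) (colour-X-darts false)))
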